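{- Let $f$ be a propositional 3CNF formula, bracketed so that $\wedge$ is binary (every subformula is either a clause $l_1\vee l_2\vee l_3$ or a conjunction $(g\wedge h)$ of subformulas). Define the affine bimodal formula $\phi_f$ inductively by: $\phi_a=(\Box_1 a)\oplus(\Box_2\Box_1 a)$ for a positive literal $a$; $\phi_{\neg a}=(\Box_1\neg a)\oplus(\Box_2\Box_1\neg a)$ for a negative literal $\neg a$; $\phi_C=\Diamond_1(\phi_{l_1}\oplus\phi_{l_2}\oplus\phi_{l_3})$ for a clause $C=l_1\vee l_2\vee l_3$; and for a subformula $(g\wedge h)$, with $\psi_g=\phi_g\oplus\Box_2\phi_g$ and $\psi_h=\phi_h\oplus\Box_2\phi_h$, $\phi_{g\wedge h}=(\Diamond_1(\psi_g\oplus\psi_h))\oplus(\Diamond_1\psi_g)\oplus(\Diamond_1\psi_h)$. If $\phi_f$ is satisfiable (in a Kripke structure with two equivalence relations), then $f$ is satisfiable.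
   Context: Here $\neg\varphi$ abbreviates $\varphi\oplus\top$ and $\Box_i\varphi$ abbreviates $\neg\Diamond_i\neg\varphi$. A Kripke structure $M=(W,R_1,R_2,\xi)$ has worlds $W$, relations $R_1,R_2\subseteq W\times W$ (here required to be equivalence relations, i.e., an $\mathbf{S5}$ structure), and a labeling $\xi$ of propositional variables by subsets of $W$. Semantics: $M,w\models p$ iff $w\in\xi(p)$; $\top$ always holds; $M,w\models\varphi\oplus\psi$ iff exactly one of $\varphi,\psi$ holds at $w$; $M,w\models\Diamond_i\varphi$ iff some $w'$ with $wR_iw'$ satisfies $\varphi$. A formula is satisfiable if it holds at some world of some such structure. -}

module Defs where

open import Data.Nat using (ℕ)
open import Data.Bool using (Bool; true; false; not; _∧_; _∨_)
open import Data.Product using (_×_; ∃)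
open import Data.Sum using (_⊎_)
open import Data.Unit using (⊤)
open import Relation.Nullary using (¬_)
open import Relation.Binary.PropositionalEquality using (_≡_)
open import Relation.Binary.Structures using (IsEquivalence)

Var : Set
Var = ℕ

data Literal : Set where
  pos : Var → Literal
  neg : Var → Literal

record Clause : Set where
  constructor clause
  field
    l₁ l₂ l₃ : Literal

data CNF3 : Set where
  cl   : Clause → CNF3
  _∧ᶠ_ : CNF3 → CNF3 → CNF3

Assignment : Set
Assignment = Var → Bool

evalLit : Assignment → Literal → Bool
evalLit v (pos a) = v a
evalLit v (neg a) = not (v a)

evalClause : Assignment → Clause → Bool
evalClause v (clause l₁ l₂ l₃) = evalLit v l₁ ∨ evalLit v l₂ ∨ evalLit v l₃

evalCNF : Assignment → CNF3 → Bool
evalCNF v (cl C)    = evalClause v C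
evalCNF v (g ∧ᶠ h)  = evalCNF v g ∧ evalCNF v h

PropSatisfiable : CNF3 → Set
PropSatisfiable f = ∃ λ (v : Assignment) → evalCNF v f ≡ true

data Agent : Set where
  one two : Agent

data Form : Set where
  var  : Var → Form
  ⊤ᶠ   : Form
  _⊕_  : Form → Form → Form
  ◇    : Agent → Form → Form

infixl 5 _⊕_

¬ᶠ : Form → Form
¬ᶠ φ = φ ⊕ ⊤ᶠ

□ : Agent → Form → Form
□ i φ = ¬ᶠ (◇ i (¬ᶠ φ))

record S5Structure : Set₁ where
  field
    W     : Set
    R     : Agent → W → W → Set
    R-equiv : ∀ i → IsEquivalence (R i)
    ξ     : Var → W → Set

open S5Structure public

_,_⊨_ : (M : S5Structure) → W M → Form → Set
M , w ⊨ var p   = ξ M p w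
M , w ⊨ ⊤ᶠ      = ⊤
M , w ⊨ (φ ⊕ ψ) = ((M , w ⊨ φ) × ¬ (M , w ⊨ ψ)) ⊎ (¬ (M , w ⊨ φ) × (M , w ⊨ ψ))
M , w ⊨ ◇ i φ   = ∃ λ w' → R M i w w' × (M , w' ⊨ φ)

ModalSatisfiable : Form → Set₁
ModalSatisfiable φ = ∃ λ (M : S5Structure) → ∃ λ (w : W M) → M , w ⊨ φ

φLit : Literal → Form
φLit (pos a) = □ one (var a) ⊕ □ two (□ one (var a))
φLit (neg a) = □ one (¬ᶠ (var a)) ⊕ □ two (□ one (¬ᶠ (var a)))

φClause : Clause → Form
φClause (clause l₁ l₂ l₃) = ◇ one (φLit l₁ ⊕ φLit l₂ ⊕ φLit l₃)

ψ : Form → Form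
ψ φ = φ ⊕ □ two φ

φ[_] : CNF3 → Form
φ[ cl C ]   = φClause C
φ[ g ∧ᶠ h ] = ◇ one (ψ φ[ g ] ⊕ ψ φ[ h ]) ⊕ ◇ one (ψ φ[ g ]) ⊕ ◇ one (ψ φ[ h ])

-- Let v(a) be "□₁ a holds at the satisfying world w". Since □₂ and □₁ are reflexive, ψ φ = φ ⊕ □₂ φ
-- can only hold where φ holds, so every literal formula φ_l forces □₁ l, which by S5 transfers to
-- all worlds of the □₁-class of w and makes l true under v. A clause formula yields a witness of
-- an odd number, hence of at least one, of its literals. For a conjunction, ◇₁(ψ_g ⊕ ψ_h) behaves
-- like the disjunction of ◇₁ψ_g and ◇₁ψ_h as far as parity is concerned, and (a ∨ b) ⊕ a ⊕ b is
-- a ∧ b, so both ◇₁ψ_g and ◇₁ψ_h hold and induction applies within the □₁-class of w.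
module Submission where

open import Defs
open import Level using (0ℓ)
open import Axiom.ExcludedMiddle using (ExcludedMiddle)
open import Axiom.DoubleNegationElimination using (DoubleNegationElimination; em⇒dne)
open import Data.Bool using (T; _∨_)
open import Data.Bool.Properties using (T-≡; T-∧; T-∨)
open import Data.Empty using (⊥-elim)
open import Data.Product using (_×_; _,_)
open import Data.Sum as Sum using (_⊎_; inj₁; inj₂)
open import Data.Unit using (tt)
open import Function.Base using (_∘_)
open import Function.Bundles using (module Equivalence)
open import Relation.Nullary using (¬_)
open import Relation.Nullary.Decidable using (⌊_⌋; fromWitness; fromWitnessFalse)
open import Relation.Binary.Structures using (IsEquivalence)

_⊻_ : Set → Set → Set
P ⊻ Q = (P × ¬ Q) ⊎ (¬ P × Q)

⊻-elimˡ : ∀ {A B} → (B → A) → A ⊻ B → A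
⊻-elimˡ B⇒A (inj₁ (a , _))  = a
⊻-elimˡ B⇒A (inj₂ (¬a , b)) = ⊥-elim (¬a (B⇒A b))

⊻₃⇒⊎ : ∀ {A B C} → (A ⊻ B) ⊻ C → A ⊎ (B ⊎ C)
⊻₃⇒⊎ (inj₁ (inj₁ (a , _) , _)) = inj₁ a
⊻₃⇒⊎ (inj₁ (inj₂ (_ , b) , _)) = inj₂ (inj₁ b)
⊻₃⇒⊎ (inj₂ (_ , c))            = inj₂ (inj₂ c)

module _ {A B D : Set} (D⇒A⊎B : D → A ⊎ B) (A⇒¬B⇒D : A → ¬ B → D) (B⇒¬A⇒D : B → ¬ A → D) where

  ⊻-parity-¬¬ˡ : (D ⊻ A) ⊻ B → ¬ ¬ A
  ⊻-parity-¬¬ˡ (inj₁ (inj₁ (d , _) , ¬b)) ¬a = Sum.[ ¬a , ¬b ] (D⇒A⊎B d)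
  ⊻-parity-¬¬ˡ (inj₁ (inj₂ (_ , a) , _))  ¬a = ¬a a
  ⊻-parity-¬¬ˡ (inj₂ (¬d⊻a , b))          ¬a = ¬d⊻a (inj₁ (B⇒¬A⇒D b ¬a , ¬a))

  ⊻-parity-¬¬ʳ : (D ⊻ A) ⊻ B → ¬ ¬ B
  ⊻-parity-¬¬ʳ (inj₁ (inj₁ (d , ¬a) , _)) ¬b = Sum.[ ¬a , ¬b ] (D⇒A⊎B d)
  ⊻-parity-¬¬ʳ (inj₁ (inj₂ (¬d , a) , _)) ¬b = ¬d (A⇒¬B⇒D a ¬b)
  ⊻-parity-¬¬ʳ (inj₂ (_ , b))             ¬b = ¬b b

module S5 (dne : DoubleNegationElimination 0ℓ) (M : S5Structure) where

  private
    module Rᵢ (i : Agent) = IsEquivalence (R-equiv M i)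

  ⊨¬ᶠ : ∀ {u} φ → ¬ (M , u ⊨ φ) → M , u ⊨ ¬ᶠ φ
  ⊨¬ᶠ φ ¬φ = inj₂ (¬φ , tt)

  ⊨¬ᶠ⁻ : ∀ {u} φ → M , u ⊨ ¬ᶠ φ → ¬ (M , u ⊨ φ)
  ⊨¬ᶠ⁻ φ (inj₁ (_ , ¬⊤)) _ = ¬⊤ tt
  ⊨¬ᶠ⁻ φ (inj₂ (¬φ , _))   = ¬φ

  ⊨□-elim : ∀ {i u u'} φ → M , u ⊨ □ i φ → R M i u u' → M , u' ⊨ φ
  ⊨□-elim {i} φ □φ uRu' = dne λ ¬φ → ⊨¬ᶠ⁻ (◇ i (¬ᶠ φ)) □φ (_ , uRu' , ⊨¬ᶠ φ ¬φ)

  ⊨□-intro : ∀ {i u} φ → (∀ {u'} → R M i u u' → M , u' ⊨ φ) → M , u ⊨ □ i φ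
  ⊨□-intro {i} φ ∀φ = ⊨¬ᶠ (◇ i (¬ᶠ φ)) λ { (_ , uRu' , ¬φ) → ⊨¬ᶠ⁻ φ ¬φ (∀φ uRu') }

  ⊨□⇒⊨ : ∀ {i u} φ → M , u ⊨ □ i φ → M , u ⊨ φ
  ⊨□⇒⊨ {i} φ □φ = ⊨□-elim φ □φ (Rᵢ.refl i)

  ⊨□-resp-R : ∀ {i u u'} φ → R M i u u' → M , u ⊨ □ i φ → M , u' ⊨ □ i φ
  ⊨□-resp-R {i} φ uRu' □φ = ⊨□-intro φ λ u'Rv → ⊨□-elim φ □φ (Rᵢ.trans i uRu' u'Rv)

  ⊨ψ⇒⊨ : ∀ {u} φ → M , u ⊨ ψ φ → M , u ⊨ φ
  ⊨ψ⇒⊨ φ = ⊻-elimˡ (⊨□⇒⊨ {two} φ)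

  module _ {i : Agent} {u : W M} (α β : Form) where

    ⊨◇⊕⇒⊎ : M , u ⊨ ◇ i (α ⊕ β) → (M , u ⊨ ◇ i α) ⊎ (M , u ⊨ ◇ i β)
    ⊨◇⊕⇒⊎ (u' , uRu' , inj₁ (a , _)) = inj₁ (u' , uRu' , a)
    ⊨◇⊕⇒⊎ (u' , uRu' , inj₂ (_ , b)) = inj₂ (u' , uRu' , b)

    ⊨◇⊕-introˡ : M , u ⊨ ◇ i α → ¬ (M , u ⊨ ◇ i β) → M , u ⊨ ◇ i (α ⊕ β)
    ⊨◇⊕-introˡ (u' , uRu' , a) ¬◇β = u' , uRu' , inj₁ (a , λ b → ¬◇β (u' , uRu' , b))

    ⊨◇⊕-introʳ : M , u ⊨ ◇ i β → ¬ (M , u ⊨ ◇ i α) → M , u ⊨ ◇ i (α ⊕ β)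
    ⊨◇⊕-introʳ (u' , uRu' , b) ¬◇α = u' , uRu' , inj₂ ((λ a → ¬◇α (u' , uRu' , a)) , b)

  ⊨◇-parity : ∀ {i u} α β → M , u ⊨ (◇ i (α ⊕ β) ⊕ ◇ i α ⊕ ◇ i β) →
              (M , u ⊨ ◇ i α) × (M , u ⊨ ◇ i β)
  ⊨◇-parity α β p = dne (⊻-parity-¬¬ˡ (⊨◇⊕⇒⊎ α β) (⊨◇⊕-introˡ α β) (⊨◇⊕-introʳ α β) p)
                  , dne (⊻-parity-¬¬ʳ (⊨◇⊕⇒⊎ α β) (⊨◇⊕-introˡ α β) (⊨◇⊕-introʳ α β) p)

lit : Literal → Form
lit (pos a) = var a
lit (neg a) = ¬ᶠ (var a)

T-∨₃ : ∀ {a b c} → T a ⊎ (T b ⊎ T c) → T (a ∨ b ∨ c)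
T-∨₃ = Equivalence.from T-∨ ∘ Sum.map₂ (Equivalence.from T-∨)

module Soundness (em : ExcludedMiddle 0ℓ) (M : S5Structure) (w : W M) where

  open S5 (em⇒dne em) M
  private module R₁ = IsEquivalence (R-equiv M one)

  valuation : Assignment
  valuation a = ⌊ em {M , w ⊨ □ one (var a)} ⌋

  ⊨□lit⇒T : ∀ l → M , w ⊨ □ one (lit l) → T (evalLit valuation l)
  ⊨□lit⇒T (pos a) □a  = fromWitness □a
  ⊨□lit⇒T (neg a) □¬a = fromWitnessFalse λ □a → ⊨¬ᶠ⁻ (var a) (⊨□⇒⊨ (¬ᶠ (var a)) □¬a) (⊨□⇒⊨ (var a) □a)

  -- φLit l is ψ (□₁ l) on the nose.
  ⊨φLit⇒⊨□lit : ∀ l {u} → M , u ⊨ φLit l → M , u ⊨ □ one (lit l)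
  ⊨φLit⇒⊨□lit (pos a) = ⊨ψ⇒⊨ (□ one (var a))
  ⊨φLit⇒⊨□lit (neg a) = ⊨ψ⇒⊨ (□ one (¬ᶠ (var a)))

  ⊨φLit⇒T : ∀ l {u} → R M one w u → M , u ⊨ φLit l → T (evalLit valuation l)
  ⊨φLit⇒T l wRu φl = ⊨□lit⇒T l (⊨□-resp-R (lit l) (R₁.sym wRu) (⊨φLit⇒⊨□lit l φl))

  ⊨φ⇒T : ∀ f {u} → R M one w u → M , u ⊨ φ[ f ] → T (evalCNF valuation f)
  ⊨φ⇒T (cl (clause l₁ l₂ l₃)) wRu (u' , uRu' , φC) =
    T-∨₃ (Sum.map (⊨φLit⇒T l₁ wRu') (Sum.map (⊨φLit⇒T l₂ wRu') (⊨φLit⇒T l₃ wRu')) (⊻₃⇒⊎ φC))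
    where
      wRu' : R M one w u'
      wRu' = R₁.trans wRu uRu'
  ⊨φ⇒T (g ∧ᶠ h) wRu φg∧h =
    let (u₁ , uRu₁ , ψg) , (u₂ , uRu₂ , ψh) = ⊨◇-parity (ψ φ[ g ]) (ψ φ[ h ]) φg∧h
    in Equivalence.from T-∧ ( ⊨φ⇒T g (R₁.trans wRu uRu₁) (⊨ψ⇒⊨ φ[ g ] ψg)
                            , ⊨φ⇒T h (R₁.trans wRu uRu₂) (⊨ψ⇒⊨ φ[ h ] ψh))

proposition1 : ExcludedMiddle 0ℓ → (f : CNF3) → ModalSatisfiable φ[ f ] → PropSatisfiable f
proposition1 em f (M , w , φf) =
  valuation , Equivalence.to T-≡ (⊨φ⇒T f (IsEquivalence.refl (R-equiv M one)) φf)
  where open Soundness em M w
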